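{- Let $D$ be an $\overrightarrow{S_{3,1}}$-free oriented graph and $v\in V(D)$ with $d^-(v)\geq 3$. Suppose $S=\{u_1,u_2,u_3\}\subseteq N^-(v)$. (i) If $\widetilde{d}^-(S)=(2,2,2)$, then the subdigraph of $D$ induced by $\{v,u_1,u_2,u_3\}\cup N^-(S)$ contains a spanning subgraph isomorphic to $H_1$. (ii) If $d^-(S)=(3,3,3)$, then the subdigraph of $D$ induced by $\{v,u_1,u_2,u_3\}\cup N^-(S)$ contains a spanning subgraph isomorphic to $H_2$.
   Context: An oriented graph is a digraph obtained from a finite simple undirected graph by orienting each edge. $N^-(u)$ is the set of in-neighbors of $u$, $d^-(u)$ its in-degree, and $N^-(S)$ the set of all in-neighbors of vertices of $S$. $d^-(S)=(d^-(u_1),d^-(u_2),d^-(u_3))$ and $\widetilde{d}^-(S)=(d^-_{V(D)\setminus S}(u_1),d^-_{V(D)\setminus S}(u_2),d^-_{V(D)\setminus S}(u_3))$, where $d^-_X(u)$ is the number of in-neighbors of $u$ in $X$. $\overrightarrow{S_{3,1}}$ is the digraph with vertices $c,w_1,w_2,w_3,z_1,z_2,z_3$ and arcs $z_iw_i$, $w_ic$ ($i=1,2,3$); $D$ is $\overrightarrow{S_{3,1}}$-free if it has no subgraph isomorphic to it. $H_1$ is the digraph on six vertices $a,b_1,b_2,b_3,c_1,c_2$ with arcs $b_ia$ for $i=1,2,3$ and $c_jb_i$ for $j=1,2$, $i=1,2,3$ (in the paper's figure $a=v$, $b_i=u_i$). $H_2$ is obtained from $H_1$ by adding the arcs $b_1b_2$,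 $b_2b_3$, $b_3b_1$. -}

module Defs where

open import Data.Nat using (ℕ; _≥_)
open import Data.Fin using (Fin; #_; _≟_)
open import Data.Bool using (Bool; true; false; T; if_then_else_; _∧_; _∨_; not)
open import Data.List using (List; []; _∷_; map; allFin)
open import Data.Nat.ListAction using (sum)
open import Data.List.Relation.Unary.All using (All)
open import Data.Product using (_×_; _,_; Σ; ∃; ∃-syntax)
open import Data.Sum using (_⊎_)
open import Function.Definitions using (Injective)
open import Relation.Binary.PropositionalEquality using (_≡_)
open import Relation.Nullary using (¬_)
open import Relation.Nullary.Decidable using (⌊_⌋)

Digraph : ℕ → Set
Digraph n = Fin n → Fin n → Bool

Arc : ∀ {n} → Digraph n → Fin n → Fin n → Set
Arc A x y = T (A x y)

record Oriented {n : ℕ} (A : Digraph n) : Set where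
  field
    irrefl : ∀ x → ¬ Arc A x x
    asym   : ∀ x y → Arc A x y → ¬ Arc A y x

Pattern : ℕ → Set
Pattern k = List (Fin k × Fin k)

ArcPreserving : ∀ {k n} → Pattern k → Digraph n → (Fin k → Fin n) → Set
ArcPreserving P A f = All (λ { (x , y) → Arc A (f x) (f y) }) P

ContainsSub : ∀ {k n} → Pattern k → Digraph n → Set
ContainsSub {k} {n} P A =
  Σ (Fin k → Fin n) λ f → Injective _≡_ _≡_ f × ArcPreserving P A f

-- S→_{3,1}: vertices 0 = c, 1,2,3 = w₁,w₂,w₃, 4,5,6 = z₁,z₂,z₃;
-- arcs zᵢwᵢ and wᵢc.
S31 : Pattern 7
S31 = (# 4 , # 1) ∷ (# 5 , # 2) ∷ (# 6 , # 3)
    ∷ (# 1 , # 0) ∷ (# 2 , # 0) ∷ (# 3 , # 0) ∷ []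

S31-free : ∀ {n} → Digraph n → Set
S31-free A = ¬ ContainsSub S31 A

-- H₁: vertices 0 = a, 1,2,3 = b₁,b₂,b₃, 4,5 = c₁,c₂;
-- arcs bᵢa and cⱼbᵢ.
H1 : Pattern 6
H1 = (# 1 , # 0) ∷ (# 2 , # 0) ∷ (# 3 , # 0)
   ∷ (# 4 , # 1) ∷ (# 4 , # 2) ∷ (# 4 , # 3)
   ∷ (# 5 , # 1) ∷ (# 5 , # 2) ∷ (# 5 , # 3) ∷ []

H2 : Pattern 6
H2 = (# 1 , # 2) ∷ (# 2 , # 3) ∷ (# 3 , # 1) ∷ H1

boolToℕ : Bool → ℕ
boolToℕ true  = 1
boolToℕ false = 0

indeg : ∀ {n} → Digraph n → Fin n → ℕ
indeg {n} A v = sum (map (λ u → boolToℕ (A u v)) (allFin n))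

inS₃ : ∀ {n} → Fin n → Fin n → Fin n → Fin n → Bool
inS₃ u₁ u₂ u₃ x = ⌊ x ≟ u₁ ⌋ ∨ ⌊ x ≟ u₂ ⌋ ∨ ⌊ x ≟ u₃ ⌋

indegOut : ∀ {n} → Digraph n → Fin n → Fin n → Fin n → Fin n → ℕ
indegOut {n} A u₁ u₂ u₃ v =
  sum (map (λ u → boolToℕ (A u v ∧ not (inS₃ u₁ u₂ u₃ u))) (allFin n))

InW : ∀ {n} → Digraph n → Fin n → Fin n → Fin n → Fin n → Fin n → Set
InW A v u₁ u₂ u₃ x =
  x ≡ v ⊎ x ≡ u₁ ⊎ x ≡ u₂ ⊎ x ≡ u₃ ⊎ Arc A x u₁ ⊎ Arc A x u₂ ⊎ Arc A x u₃

-- The subdigraph of D induced by W = {v,u₁,u₂,u₃} ∪ N⁻(S) contains a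
-- spanning subgraph isomorphic to the 6-vertex pattern P: there is a
-- bijection f : Fin 6 → W (injective, image exactly W) that maps every
-- arc of P to an arc of D (arcs of D inside W are the arcs of D[W]).
SpanningInInduced : ∀ {n} → Pattern 6 → Digraph n
                  → Fin n → Fin n → Fin n → Fin n → Set
SpanningInInduced {n} P A v u₁ u₂ u₃ =
  Σ (Fin 6 → Fin n) λ f →
    Injective _≡_ _≡_ f
    × (∀ i → InW A v u₁ u₂ u₃ (f i))
    × (∀ x → InW A v u₁ u₂ u₃ x → ∃[ i ] f i ≡ x)
    × ArcPreserving P A f

{-# OPTIONS --safe #-}
-- Let Pᵢ be the set of in-neighbours of uᵢ outside S. Distinct representatives zᵢ ∈ Pᵢ
-- would give a copy zᵢ → uᵢ → v of S→_{3,1}, so (P₁, P₂, P₃) has no SDR.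
-- (i) If every |Pᵢ| = 2, Hall's condition forces P₁ = P₂ = P₃ = {c₁, c₂}, and
-- v, u₁, u₂, u₃, c₁, c₂ span H₁.
-- (ii) If every d⁻(uᵢ) = 3, then |Pᵢ| = 3 − eᵢ, where eᵢ ≤ 2 is the in-degree of uᵢ inside S
-- and e₁ + e₂ + e₃ ≤ 3. Were some eᵢ = 0, then |Pᵢ| = 3 while one of the other two sets has
-- at least two elements, and a greedy choice would produce an SDR. So every uᵢ has an
-- in-neighbour in S, which makes S a directed triangle with all eᵢ = 1; thus |Pᵢ| = 2, and
-- (i) together with the triangle gives H₂.

module Submission where

open import Defs
open import Data.Bool using (Bool; true; false; T; not; _∧_; _∨_)
open import Data.Bool.Properties using (∧-identityʳ; ∧-zeroʳ; T-∧)
open import Data.Empty using (⊥-elim)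
open import Data.Fin using (Fin; zero; suc; _≟_)
open import Data.List using (map; allFin; tabulate)
open import Data.List.Properties using (map-tabulate)
open import Data.List.Relation.Unary.All using ([]; _∷_)
open import Data.Nat using (ℕ; zero; suc; _+_; _≤_; _<_; _≥_; z≤n; s≤s)
open import Data.Nat.ListAction using (sum)
open import Data.Nat.Properties
  using (≤-refl; ≤-trans; ≤-reflexive; <-irrefl; +-assoc; +-mono-≤; +-monoˡ-≤; +-cancelˡ-≤;
         m≤m+n; m≤n+m; m+n≤o⇒n≤o; suc-injective; ≤-pred; module ≤-Reasoning)
open import Data.Nat.Tactic.RingSolver using (solve-∀)
open import Data.Product using (_×_; _,_; proj₁; proj₂; ∃-syntax; ∃₂)
open import Data.Sum using (_⊎_; inj₁; inj₂)
open import Data.Unit using (tt)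
open import Data.Vec using (Vec; []; _∷_; lookup)
open import Data.Vec.Membership.Propositional using (_∈_)
open import Data.Vec.Relation.Unary.All using (All; []; _∷_)
open import Data.Vec.Relation.Unary.All.Properties using (lookup⁺)
open import Data.Vec.Relation.Unary.AllPairs using ([]; _∷_)
open import Data.Vec.Relation.Unary.Any using (here; there; index)
open import Data.Vec.Relation.Unary.Any.Properties using (lookup-index)
open import Data.Vec.Relation.Unary.Unique.Propositional using (Unique)
open import Data.Vec.Relation.Unary.Unique.Propositional.Properties using (lookup-injective)
open import Function using (_∘_; id; Equivalence)
open import Level using (Level)
open import Relation.Binary.PropositionalEquality
  using (_≡_; _≢_; refl; sym; trans; cong; cong₂; subst; ≢-sym; module ≡-Reasoning)
open import Relation.Nullary using (¬_; yes; no)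
open import Relation.Nullary.Decidable using (⌊_⌋; toWitnessFalse; fromWitnessFalse)
open import Relation.Unary using (Pred; _⊆_; _≐_; ｛_｝; _∪_)

private variable
  ℓ : Level
  n k : ℕ

-- Counting the elements of a Boolean predicate on Fin n

bit≤1 : ∀ x → boolToℕ x ≤ 1
bit≤1 true  = ≤-refl
bit≤1 false = z≤n

T⇒bit≡1 : ∀ {x} → T x → boolToℕ x ≡ 1
T⇒bit≡1 {true} _ = refl

¬T⇒bit≡0 : ∀ {x} → ¬ T x → boolToℕ x ≡ 0
¬T⇒bit≡0 {true}  ¬x = ⊥-elim (¬x tt)
¬T⇒bit≡0 {false} _  = refl

bits≤1 : ∀ x y → (T x → ¬ T y) → boolToℕ x + boolToℕ y ≤ 1
bits≤1 true  true  x⇒¬y = ⊥-elim (x⇒¬y tt tt)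
bits≤1 true  false _    = ≤-refl
bits≤1 false y     _    = bit≤1 y

bits≤2 : ∀ x y z → ¬ T x ⊎ ¬ T y ⊎ ¬ T z → boolToℕ x + boolToℕ y + boolToℕ z ≤ 2
bits≤2 true  true  true  (inj₁ ¬x)        = ⊥-elim (¬x tt)
bits≤2 true  true  true  (inj₂ (inj₁ ¬y)) = ⊥-elim (¬y tt)
bits≤2 true  true  true  (inj₂ (inj₂ ¬z)) = ⊥-elim (¬z tt)
bits≤2 true  true  false _                = ≤-refl
bits≤2 true  false z     _                = s≤s (bit≤1 z)
bits≤2 false y     z     _                = +-mono-≤ (bit≤1 y) (bit≤1 z)

∧-not-∨₃ : ∀ x a b c → ((x ∧ not a) ∧ not b) ∧ not c ≡ x ∧ not (a ∨ b ∨ c)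
∧-not-∨₃ false _     _     _ = refl
∧-not-∨₃ true  true  _     _ = refl
∧-not-∨₃ true  false true  _ = refl
∧-not-∨₃ true  false false _ = refl

bits≢0 : ∀ {x y z} → boolToℕ x + boolToℕ y + boolToℕ z ≢ 0 → T x ⊎ T y ⊎ T z
bits≢0 {true}                  _   = inj₁ tt
bits≢0 {false} {true}          _   = inj₂ (inj₁ tt)
bits≢0 {false} {false} {true}  _   = inj₂ (inj₂ tt)
bits≢0 {false} {false} {false} ≢0 = ⊥-elim (≢0 refl)

count : (Fin n → Bool) → ℕ
count {zero}  p = 0
count {suc n} p = boolToℕ (p zero) + count (p ∘ suc)

sum-allFin : (p : Fin n → Bool) → sum (map (boolToℕ ∘ p) (allFin n)) ≡ count p
sum-allFin {n} p = trans (cong sum (map-tabulate id (boolToℕ ∘ p))) (sum-tabulate p)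
  where
  sum-tabulate : ∀ {m} (q : Fin m → Bool) → sum (tabulate (boolToℕ ∘ q)) ≡ count q
  sum-tabulate {zero}  q = refl
  sum-tabulate {suc m} q = cong (boolToℕ (q zero) +_) (sum-tabulate (q ∘ suc))

count-cong : {p q : Fin n → Bool} → (∀ z → p z ≡ q z) → count p ≡ count q
count-cong {zero}  p≗q = refl
count-cong {suc n} p≗q = cong₂ _+_ (cong boolToℕ (p≗q zero)) (count-cong (p≗q ∘ suc))

infixl 6 _─_

_─_ : (Fin n → Bool) → Fin n → Fin n → Bool
(p ─ a) z = p z ∧ not ⌊ z ≟ a ⌋

T-─⁻ : (p : Fin n → Bool) {a z : Fin n} → T ((p ─ a) z) → T (p z) × z ≢ a
T-─⁻ p t with pz , z≉a ← Equivalence.to T-∧ t = pz , toWitnessFalse z≉a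

T-─⁺ : (p : Fin n → Bool) {a z : Fin n} → T (p z) → z ≢ a → T ((p ─ a) z)
T-─⁺ p pz z≢a = Equivalence.from T-∧ (pz , fromWitnessFalse z≢a)

─-≢ : (p : Fin n → Bool) {a z : Fin n} → z ≢ a → (p ─ a) z ≡ p z
─-≢ p {a} {z} z≢a with z ≟ a
... | yes z≡a = ⊥-elim (z≢a z≡a)
... | no  _   = ∧-identityʳ (p z)

count-─ : (p : Fin n → Bool) (a : Fin n) → count p ≡ boolToℕ (p a) + count (p ─ a)
count-─ {suc n} p zero rewrite ∧-zeroʳ (p zero) =
  cong (boolToℕ (p zero) +_) (count-cong (λ z → sym (∧-identityʳ (p (suc z)))))
count-─ {suc n} p (suc a) rewrite ∧-identityʳ (p zero) = begin
  boolToℕ (p zero) + count (p ∘ suc)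
    ≡⟨ cong (boolToℕ (p zero) +_) (count-─ (p ∘ suc) a) ⟩
  boolToℕ (p zero) + (boolToℕ (p (suc a)) + count (p ∘ suc ─ a))
    ≡⟨ swap-head (boolToℕ (p zero)) (boolToℕ (p (suc a))) _ ⟩
  boolToℕ (p (suc a)) + (boolToℕ (p zero) + count (p ∘ suc ─ a))
    ≡⟨ cong (λ m → boolToℕ (p (suc a)) + (boolToℕ (p zero) + m)) (count-cong suc-─) ⟩
  boolToℕ (p (suc a)) + (boolToℕ (p zero) + count ((p ─ suc a) ∘ suc)) ∎
  where
  open ≡-Reasoning
  -- ⌊_⌋ does not compute through the map′ in the definition of suc z ≟ suc a.
  suc-─ : ∀ z → (p ∘ suc ─ a) z ≡ (p ─ suc a) (suc z)
  suc-─ z with z ≟ a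
  ... | yes _ = refl
  ... | no  _ = refl
  swap-head : ∀ x y w → x + (y + w) ≡ y + (x + w)
  swap-head = solve-∀

count≤1+count-─ : (p : Fin n → Bool) (a : Fin n) → count p ≤ suc (count (p ─ a))
count≤1+count-─ p a = ≤-trans (≤-reflexive (count-─ p a)) (+-monoˡ-≤ _ (bit≤1 (p a)))

count-─₃ : (p : Fin n → Bool) {a b c : Fin n} → a ≢ b → a ≢ c → b ≢ c →
           count p ≡ boolToℕ (p a) + boolToℕ (p b) + boolToℕ (p c) + count (p ─ a ─ b ─ c)
count-─₃ p {a} {b} {c} a≢b a≢c b≢c = begin
  count p
    ≡⟨ count-─ p a ⟩
  pa + count (p ─ a)
    ≡⟨ cong (pa +_) (count-─ (p ─ a) b) ⟩
  pa + (boolToℕ ((p ─ a) b) + count (p ─ a ─ b))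
    ≡⟨ cong (λ m → pa + (boolToℕ ((p ─ a) b) + m)) (count-─ (p ─ a ─ b) c) ⟩
  pa + (boolToℕ ((p ─ a) b) + (boolToℕ ((p ─ a ─ b) c) + rest))
    ≡⟨ cong₂ (λ x y → pa + (boolToℕ x + (boolToℕ y + rest)))
             (─-≢ p (≢-sym a≢b)) (trans (─-≢ (p ─ a) (≢-sym b≢c)) (─-≢ p (≢-sym a≢c))) ⟩
  pa + (pb + (pc + rest))
    ≡⟨ regroup pa pb pc rest ⟩
  pa + pb + pc + rest ∎
  where
  open ≡-Reasoning
  pa pb pc rest : ℕ
  pa = boolToℕ (p a)
  pb = boolToℕ (p b)
  pc = boolToℕ (p c)
  rest = count (p ─ a ─ b ─ c)
  regroup : ∀ x y z w → x + (y + (z + w)) ≡ x + y + z + w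
  regroup = solve-∀

witness : (p : Fin n → Bool) → 0 < count p → ∃[ z ] T (p z)
witness {suc n} p pos with p zero in p0
... | true  = zero , subst T (sym p0) tt
... | false with z , pz ← witness (p ∘ suc) pos = suc z , pz

count-avoid : (p : Fin n → Bool) (xs : Vec (Fin n) k) → k < count p →
              ∃[ z ] T (p z) × All (z ≢_) xs
count-avoid p []       pos = let z , pz = witness p pos in z , pz , []
count-avoid p (x ∷ xs) k<count
  with z , pz , z∉xs ← count-avoid (p ─ x) xs (≤-pred (≤-trans k<count (count≤1+count-─ p x)))
  with pz , z≢x ← T-─⁻ p pz
  = z , pz , z≢x ∷ z∉xs

unique≤count : (p : Fin n → Bool) (xs : Vec (Fin n) k) → Unique xs → All (T ∘ p) xs → k ≤ count p
unique≤count p []       _                  _          = z≤n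
unique≤count p (x ∷ xs) (x∉xs ∷ unique-xs) (px ∷ pxs) = begin
  suc _                         ≤⟨ s≤s (unique≤count (p ─ x) xs unique-xs (members x∉xs pxs)) ⟩
  suc (count (p ─ x))           ≡⟨ cong (_+ count (p ─ x)) (sym (T⇒bit≡1 px)) ⟩
  boolToℕ (p x) + count (p ─ x) ≡⟨ sym (count-─ p x) ⟩
  count p                       ∎
  where
  open ≤-Reasoning
  members : ∀ {m} {ys : Vec (Fin _) m} → All (x ≢_) ys → All (T ∘ p) ys → All (T ∘ (p ─ x)) ys
  members []           []         = []
  members (x≢y ∷ x∉ys) (py ∷ pys) = T-─⁺ p py (≢-sym x≢y) ∷ members x∉ys pys

count≡2⇒pair : (p : Fin n → Bool) → count p ≡ 2 →
               ∃₂ λ a b → a ≢ b × (T ∘ p) ≐ ｛ a ｝ ∪ ｛ b ｝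
count≡2⇒pair p count≡2
  with a , pa , []       ← count-avoid p []       (subst (1 ≤_) (sym count≡2) (s≤s z≤n))
  with b , pb , b≢a ∷ [] ← count-avoid p (a ∷ []) (subst (2 ≤_) (sym count≡2) ≤-refl)
  = a , b , ≢-sym b≢a , only , (λ { (inj₁ refl) → pa ; (inj₂ refl) → pb })
  where
  only : T ∘ p ⊆ ｛ a ｝ ∪ ｛ b ｝
  only {z} pz with a ≟ z | b ≟ z
  ... | yes a≡z | _       = inj₁ a≡z
  ... | no  _   | yes b≡z = inj₂ b≡z
  ... | no  a≢z | no  b≢z =
    ⊥-elim (<-irrefl (sym count≡2)
      (unique≤count p (a ∷ b ∷ z ∷ [])
        ((≢-sym b≢a ∷ a≢z ∷ []) ∷ (b≢z ∷ []) ∷ [] ∷ []) (pa ∷ pb ∷ pz ∷ [])))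

-- Systems of distinct representatives

data SDR {ℓ} (P Q R : Pred (Fin n) ℓ) : Set ℓ where
  sdr : ∀ {x y z} → P x → Q y → R z → x ≢ y → x ≢ z → y ≢ z → SDR P Q R

module _ {P Q R : Pred (Fin n) ℓ} where

  SDR-swap₁₂ : SDR P Q R → SDR Q P R
  SDR-swap₁₂ (sdr px qy rz x≢y x≢z y≢z) = sdr qy px rz (≢-sym x≢y) y≢z x≢z

  SDR-swap₂₃ : SDR P Q R → SDR P R Q
  SDR-swap₂₃ (sdr px qy rz x≢y x≢z y≢z) = sdr px rz qy x≢z x≢y (≢-sym y≢z)

greedy-SDR : {p q r : Fin n → Bool} → 1 ≤ count p → 2 ≤ count q → 3 ≤ count r →
             SDR (T ∘ p) (T ∘ q) (T ∘ r)
greedy-SDR {p = p} {q} {r} 1≤p 2≤q 3≤r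
  with x , px , []              ← count-avoid p []           1≤p
  with y , qy , y≢x ∷ []        ← count-avoid q (x ∷ [])     2≤q
  with z , rz , z≢x ∷ z≢y ∷ []  ← count-avoid r (x ∷ y ∷ []) 3≤r
  = sdr px qy rz (≢-sym y≢x) (≢-sym z≢x) (≢-sym z≢y)

HasTwo : Pred (Fin n) ℓ → Set ℓ
HasTwo P = ∃₂ λ a b → a ≢ b × P a × P b

pair⇒HasTwo : {P : Pred (Fin n) ℓ} {a b : Fin n} → a ≢ b → P ≐ ｛ a ｝ ∪ ｛ b ｝ → HasTwo P
pair⇒HasTwo a≢b (_ , pair⊆P) = _ , _ , a≢b , pair⊆P (inj₁ refl) , pair⊆P (inj₂ refl)

HasTwo-avoid : {P : Pred (Fin n) ℓ} → HasTwo P → ∀ x → ∃[ z ] P z × z ≢ x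
HasTwo-avoid (a , b , a≢b , pa , pb) x with a ≟ x
... | yes refl = b , pb , ≢-sym a≢b
... | no  a≢x  = a , pa , a≢x

no-SDR⇒⊆ : {P Q R : Pred (Fin n) ℓ} → ¬ SDR P Q R → HasTwo Q → HasTwo R → P ⊆ Q
no-SDR⇒⊆ no-sdr (a , b , a≢b , qa , qb) two-R {x} px
  with z , rz , z≢x ← HasTwo-avoid two-R x
  with a ≟ x | b ≟ x
... | yes refl | _        = qa
... | no  _    | yes refl = qb
... | no  a≢x  | no  b≢x  with a ≟ z
...   | yes refl = ⊥-elim (no-sdr (sdr px qb rz (≢-sym b≢x) (≢-sym z≢x) (≢-sym a≢b)))
...   | no  a≢z  = ⊥-elim (no-sdr (sdr px qa rz (≢-sym a≢x) (≢-sym z≢x) a≢z))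

+≡⇒≤ : ∀ {m n o k} → m + n ≡ k + o → m ≤ k → o ≤ n
+≡⇒≤ {m} {n} {o} {k} eq m≤k = +-cancelˡ-≤ k o n (subst (_≤ k + n) eq (+-monoˡ-≤ n m≤k))

m+n≤3⇒ : ∀ m {n} → m + n ≤ 3 → m ≤ 1 ⊎ n ≤ 1
m+n≤3⇒ zero          _                = inj₁ z≤n
m+n≤3⇒ (suc zero)    _                = inj₁ ≤-refl
m+n≤3⇒ (suc (suc m)) (s≤s (s≤s m+n≤1)) = inj₂ (m+n≤o⇒n≤o m m+n≤1)

-- e, f, g are the in-degrees inside S of three vertices of in-degree 3 whose in-neighbours
-- outside S are p, q, r; the third vertex is a source of S.
source⇒SDR : {p q r : Fin n → Bool} {e f g : ℕ} →
             e + count p ≡ 3 → f + count q ≡ 3 → g + count r ≡ 3 → g ≡ 0 →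
             e ≤ 2 → f ≤ 2 → e + f ≤ 3 → SDR (T ∘ p) (T ∘ q) (T ∘ r)
source⇒SDR {e = e} ep fq gr refl e≤2 f≤2 e+f≤3 with m+n≤3⇒ e e+f≤3
... | inj₂ f≤1 = greedy-SDR (+≡⇒≤ ep e≤2) (+≡⇒≤ fq f≤1) (+≡⇒≤ gr ≤-refl)
... | inj₁ e≤1 = SDR-swap₁₂ (greedy-SDR (+≡⇒≤ fq f≤2) (+≡⇒≤ ep e≤1) (+≡⇒≤ gr ≤-refl))

-- Oriented graphs and spanning subgraphs

DirectedTriangle : Digraph n → Fin n → Fin n → Fin n → Set
DirectedTriangle A x y z = Arc A x y × Arc A y z × Arc A z x

module _ {A : Digraph n} (oriented : Oriented A) where
  open Oriented oriented

  arc⇒≢ : ∀ {x y} → Arc A x y → x ≢ y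
  arc⇒≢ {x} x→x refl = irrefl x x→x

  path⇒≢ : ∀ {x y z} → Arc A x y → Arc A y z → x ≢ z
  path⇒≢ x→y y→x refl = asym _ _ x→y y→x

  in-neighbours⇒triangle : ∀ {x y z} →
    Arc A x x ⊎ Arc A y x ⊎ Arc A z x →
    Arc A x y ⊎ Arc A y y ⊎ Arc A z y →
    Arc A x z ⊎ Arc A y z ⊎ Arc A z z →
    DirectedTriangle A x y z ⊎ DirectedTriangle A x z y
  in-neighbours⇒triangle (inj₁ x→x) _ _ = ⊥-elim (irrefl _ x→x)
  in-neighbours⇒triangle _ (inj₂ (inj₁ y→y)) _ = ⊥-elim (irrefl _ y→y)
  in-neighbours⇒triangle _ _ (inj₂ (inj₂ z→z)) = ⊥-elim (irrefl _ z→z)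
  in-neighbours⇒triangle (inj₂ (inj₂ z→x)) _ (inj₁ x→z) = ⊥-elim (asym _ _ z→x x→z)
  in-neighbours⇒triangle (inj₂ (inj₂ z→x)) (inj₁ x→y) (inj₂ (inj₁ y→z)) = inj₁ (x→y , y→z , z→x)
  in-neighbours⇒triangle (inj₂ (inj₂ _)) (inj₂ (inj₂ z→y)) (inj₂ (inj₁ y→z)) =
    ⊥-elim (asym _ _ z→y y→z)
  in-neighbours⇒triangle (inj₂ (inj₁ y→x)) (inj₁ x→y) _ = ⊥-elim (asym _ _ y→x x→y)
  in-neighbours⇒triangle (inj₂ (inj₁ y→x)) (inj₂ (inj₂ z→y)) (inj₁ x→z) = inj₂ (x→z , z→y , y→x)
  in-neighbours⇒triangle (inj₂ (inj₁ _)) (inj₂ (inj₂ z→y)) (inj₂ (inj₁ y→z)) =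
    ⊥-elim (asym _ _ z→y y→z)

InW-swap₂₃ : ∀ {A : Digraph n} {v u₁ u₂ u₃ x} → InW A v u₁ u₂ u₃ x → InW A v u₁ u₃ u₂ x
InW-swap₂₃ (inj₁ x≡v) = inj₁ x≡v
InW-swap₂₃ (inj₂ (inj₁ x≡u₁)) = inj₂ (inj₁ x≡u₁)
InW-swap₂₃ (inj₂ (inj₂ (inj₁ x≡u₂))) = inj₂ (inj₂ (inj₂ (inj₁ x≡u₂)))
InW-swap₂₃ (inj₂ (inj₂ (inj₂ (inj₁ x≡u₃)))) = inj₂ (inj₂ (inj₁ x≡u₃))
InW-swap₂₃ (inj₂ (inj₂ (inj₂ (inj₂ (inj₁ x→u₁))))) = inj₂ (inj₂ (inj₂ (inj₂ (inj₁ x→u₁))))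
InW-swap₂₃ (inj₂ (inj₂ (inj₂ (inj₂ (inj₂ (inj₁ x→u₂)))))) = inj₂ (inj₂ (inj₂ (inj₂ (inj₂ (inj₂ x→u₂)))))
InW-swap₂₃ (inj₂ (inj₂ (inj₂ (inj₂ (inj₂ (inj₂ x→u₃)))))) = inj₂ (inj₂ (inj₂ (inj₂ (inj₂ (inj₁ x→u₃)))))

module _ {A : Digraph n} {v u₁ u₂ u₃ : Fin n} where

  SpanningInInduced-swap₂₃ : ∀ {P} → SpanningInInduced P A v u₁ u₃ u₂ → SpanningInInduced P A v u₁ u₂ u₃
  SpanningInInduced-swap₂₃ (f , injective , into , onto , arcs) =
    f , injective , InW-swap₂₃ {A = A} ∘ into , (λ x → onto x ∘ InW-swap₂₃ {A = A}) , arcs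

  spanning-lookup : (P : Pattern 6) (ws : Vec (Fin n) 6) → Unique ws → All (InW A v u₁ u₂ u₃) ws →
                    (∀ {x} → InW A v u₁ u₂ u₃ x → x ∈ ws) → ArcPreserving P A (lookup ws) →
                    SpanningInInduced P A v u₁ u₂ u₃
  spanning-lookup P ws unique into onto arcs =
    lookup ws , (λ {i} {j} → lookup-injective unique i j) , lookup⁺ into ,
    (λ x x∈W → let x∈ws = onto x∈W in index x∈ws , sym (lookup-index x∈ws)) , arcs

-- Three in-neighbours of a vertex

module InStar {n} (A : Digraph n) (oriented : Oriented A) (free : S31-free A)
  (v u₁ u₂ u₃ : Fin n) (u₁≢u₂ : u₁ ≢ u₂) (u₁≢u₃ : u₁ ≢ u₃) (u₂≢u₃ : u₂ ≢ u₃)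
  (u₁→v : Arc A u₁ v) (u₂→v : Arc A u₂ v) (u₃→v : Arc A u₃ v) where

  open Oriented oriented

  outside : Fin n → Bool
  outside z = not (inS₃ u₁ u₂ u₃ z)

  N⁻∖Sᵇ : Fin n → Fin n → Bool
  N⁻∖Sᵇ u z = A z u ∧ outside z

  N⁻∖S : Fin n → Pred (Fin n) _
  N⁻∖S u = T ∘ N⁻∖Sᵇ u

  indegOut≡count : ∀ u → indegOut A u₁ u₂ u₃ u ≡ count (N⁻∖Sᵇ u)
  indegOut≡count u = sum-allFin (N⁻∖Sᵇ u)

  ∈S⊎outside : ∀ z → (z ≡ u₁ ⊎ z ≡ u₂ ⊎ z ≡ u₃) ⊎ T (outside z)
  ∈S⊎outside z with z ≟ u₁ | z ≟ u₂ | z ≟ u₃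
  ... | yes z≡u₁ | _        | _        = inj₁ (inj₁ z≡u₁)
  ... | no  _    | yes z≡u₂ | _        = inj₁ (inj₂ (inj₁ z≡u₂))
  ... | no  _    | no  _    | yes z≡u₃ = inj₁ (inj₂ (inj₂ z≡u₃))
  ... | no  _    | no  _    | no  _    = inj₂ tt

  outside⇒∉S : ∀ {z} → T (outside z) → u₁ ≢ z × u₂ ≢ z × u₃ ≢ z
  outside⇒∉S {z} out with z ≟ u₁ | z ≟ u₂ | z ≟ u₃
  ... | yes _    | _        | _        = ⊥-elim out
  ... | no  _    | yes _    | _        = ⊥-elim out
  ... | no  _    | no  _    | yes _    = ⊥-elim out
  ... | no  z≢u₁ | no  z≢u₂ | no  z≢u₃ = ≢-sym z≢u₁ , ≢-sym z≢u₂ , ≢-sym z≢u₃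

  N⁻∖S-arc : ∀ {u z} → N⁻∖S u z → Arc A z u
  N⁻∖S-arc = proj₁ ∘ Equivalence.to T-∧

  N⁻∖S-fresh : ∀ {u z} → Arc A u v → N⁻∖S u z → v ≢ z × u₁ ≢ z × u₂ ≢ z × u₃ ≢ z
  N⁻∖S-fresh u→v z∈N⁻∖S with z→u , out ← Equivalence.to T-∧ z∈N⁻∖S =
    ≢-sym (path⇒≢ oriented z→u u→v) , outside⇒∉S out

  v≢u₁ : v ≢ u₁
  v≢u₁ = ≢-sym (arc⇒≢ oriented u₁→v)

  v≢u₂ : v ≢ u₂
  v≢u₂ = ≢-sym (arc⇒≢ oriented u₂→v)

  v≢u₃ : v ≢ u₃
  v≢u₃ = ≢-sym (arc⇒≢ oriented u₃→v)

  no-SDR : ¬ SDR (N⁻∖S u₁) (N⁻∖S u₂) (N⁻∖S u₃)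
  no-SDR (sdr {z₁} {z₂} {z₃} z₁∈N⁻∖S z₂∈N⁻∖S z₃∈N⁻∖S z₁≢z₂ z₁≢z₃ z₂≢z₃)
    with v≢z₁ , u₁≢z₁ , u₂≢z₁ , u₃≢z₁ ← N⁻∖S-fresh u₁→v z₁∈N⁻∖S
    with v≢z₂ , u₁≢z₂ , u₂≢z₂ , u₃≢z₂ ← N⁻∖S-fresh u₂→v z₂∈N⁻∖S
    with v≢z₃ , u₁≢z₃ , u₂≢z₃ , u₃≢z₃ ← N⁻∖S-fresh u₃→v z₃∈N⁻∖S
    = free (lookup (v ∷ u₁ ∷ u₂ ∷ u₃ ∷ z₁ ∷ z₂ ∷ z₃ ∷ []) , (λ {i} {j} → lookup-injective distinct i j) ,
            N⁻∖S-arc z₁∈N⁻∖S ∷ N⁻∖S-arc z₂∈N⁻∖S ∷ N⁻∖S-arc z₃∈N⁻∖S ∷ u₁→v ∷ u₂→v ∷ u₃→v ∷ [])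
    where
    distinct : Unique (v ∷ u₁ ∷ u₂ ∷ u₃ ∷ z₁ ∷ z₂ ∷ z₃ ∷ [])
    distinct = (v≢u₁ ∷ v≢u₂ ∷ v≢u₃ ∷ v≢z₁ ∷ v≢z₂ ∷ v≢z₃ ∷ [])
             ∷ (u₁≢u₂ ∷ u₁≢u₃ ∷ u₁≢z₁ ∷ u₁≢z₂ ∷ u₁≢z₃ ∷ [])
             ∷ (u₂≢u₃ ∷ u₂≢z₁ ∷ u₂≢z₂ ∷ u₂≢z₃ ∷ [])
             ∷ (u₃≢z₁ ∷ u₃≢z₂ ∷ u₃≢z₃ ∷ [])
             ∷ (z₁≢z₂ ∷ z₁≢z₃ ∷ [])
             ∷ (z₂≢z₃ ∷ [])
             ∷ [] ∷ []

  record CommonPair (c₁ c₂ : Fin n) : Set where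
    field
      c₁≢c₂ : c₁ ≢ c₂
      at-u₁ : N⁻∖S u₁ ≐ ｛ c₁ ｝ ∪ ｛ c₂ ｝
      at-u₂ : N⁻∖S u₂ ≐ ｛ c₁ ｝ ∪ ｛ c₂ ｝
      at-u₃ : N⁻∖S u₃ ≐ ｛ c₁ ｝ ∪ ｛ c₂ ｝

  common-pair : count (N⁻∖Sᵇ u₁) ≡ 2 → count (N⁻∖Sᵇ u₂) ≡ 2 → count (N⁻∖Sᵇ u₃) ≡ 2 →
                ∃₂ CommonPair
  common-pair two₁ two₂ two₃
    with c₁ , c₂ , c₁≢c₂ , P₁≐pair ← count≡2⇒pair (N⁻∖Sᵇ u₁) two₁
    with _ , _ , a₂≢b₂ , P₂≐pair ← count≡2⇒pair (N⁻∖Sᵇ u₂) two₂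
    with _ , _ , a₃≢b₃ , P₃≐pair ← count≡2⇒pair (N⁻∖Sᵇ u₃) two₃
    = c₁ , c₂ , record
      { c₁≢c₂ = c₁≢c₂
      ; at-u₁ = P₁≐pair
      ; at-u₂ = (λ z∈ → proj₁ P₁≐pair (P₂⊆P₁ z∈)) , (λ z∈ → P₁⊆P₂ (proj₂ P₁≐pair z∈))
      ; at-u₃ = (λ z∈ → proj₁ P₁≐pair (P₃⊆P₁ z∈)) , (λ z∈ → P₁⊆P₃ (proj₂ P₁≐pair z∈))
      }
    where
    has-two₁ : HasTwo (N⁻∖S u₁)
    has-two₁ = pair⇒HasTwo c₁≢c₂ P₁≐pair
    has-two₂ : HasTwo (N⁻∖S u₂)
    has-two₂ = pair⇒HasTwo a₂≢b₂ P₂≐pair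
    has-two₃ : HasTwo (N⁻∖S u₃)
    has-two₃ = pair⇒HasTwo a₃≢b₃ P₃≐pair
    P₁⊆P₂ : N⁻∖S u₁ ⊆ N⁻∖S u₂
    P₁⊆P₂ = no-SDR⇒⊆ no-SDR has-two₂ has-two₃
    P₂⊆P₁ : N⁻∖S u₂ ⊆ N⁻∖S u₁
    P₂⊆P₁ = no-SDR⇒⊆ (no-SDR ∘ SDR-swap₁₂) has-two₁ has-two₃
    P₁⊆P₃ : N⁻∖S u₁ ⊆ N⁻∖S u₃
    P₁⊆P₃ = no-SDR⇒⊆ (no-SDR ∘ SDR-swap₂₃) has-two₃ has-two₂
    P₃⊆P₁ : N⁻∖S u₃ ⊆ N⁻∖S u₁
    P₃⊆P₁ = no-SDR⇒⊆ (no-SDR ∘ SDR-swap₂₃ ∘ SDR-swap₁₂) has-two₁ has-two₂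

  module _ {c₁ c₂ : Fin n} (pair : CommonPair c₁ c₂) where
    open CommonPair pair

    H-vertices : Vec (Fin n) 6
    H-vertices = v ∷ u₁ ∷ u₂ ∷ u₃ ∷ c₁ ∷ c₂ ∷ []

    c₁∈ : ∀ {u} → N⁻∖S u ≐ ｛ c₁ ｝ ∪ ｛ c₂ ｝ → N⁻∖S u c₁
    c₁∈ (_ , pair⊆) = pair⊆ (inj₁ refl)

    c₂∈ : ∀ {u} → N⁻∖S u ≐ ｛ c₁ ｝ ∪ ｛ c₂ ｝ → N⁻∖S u c₂
    c₂∈ (_ , pair⊆) = pair⊆ (inj₂ refl)

    H1-arcs : ArcPreserving H1 A (lookup H-vertices)
    H1-arcs = u₁→v ∷ u₂→v ∷ u₃→v
            ∷ N⁻∖S-arc (c₁∈ at-u₁) ∷ N⁻∖S-arc (c₁∈ at-u₂) ∷ N⁻∖S-arc (c₁∈ at-u₃)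
            ∷ N⁻∖S-arc (c₂∈ at-u₁) ∷ N⁻∖S-arc (c₂∈ at-u₂) ∷ N⁻∖S-arc (c₂∈ at-u₃)
            ∷ []

    spanning : (P : Pattern 6) → ArcPreserving P A (lookup H-vertices) →
               SpanningInInduced P A v u₁ u₂ u₃
    spanning P = spanning-lookup P H-vertices distinct into onto
      where
      distinct : Unique H-vertices
      distinct
        with v≢c₁ , u₁≢c₁ , u₂≢c₁ , u₃≢c₁ ← N⁻∖S-fresh u₁→v (c₁∈ at-u₁)
        with v≢c₂ , u₁≢c₂ , u₂≢c₂ , u₃≢c₂ ← N⁻∖S-fresh u₁→v (c₂∈ at-u₁)
        = (v≢u₁ ∷ v≢u₂ ∷ v≢u₃ ∷ v≢c₁ ∷ v≢c₂ ∷ [])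
        ∷ (u₁≢u₂ ∷ u₁≢u₃ ∷ u₁≢c₁ ∷ u₁≢c₂ ∷ [])
        ∷ (u₂≢u₃ ∷ u₂≢c₁ ∷ u₂≢c₂ ∷ [])
        ∷ (u₃≢c₁ ∷ u₃≢c₂ ∷ [])
        ∷ (c₁≢c₂ ∷ [])
        ∷ [] ∷ []

      into : All (InW A v u₁ u₂ u₃) H-vertices
      into = inj₁ refl ∷ inj₂ (inj₁ refl) ∷ inj₂ (inj₂ (inj₁ refl)) ∷ inj₂ (inj₂ (inj₂ (inj₁ refl)))
           ∷ inj₂ (inj₂ (inj₂ (inj₂ (inj₁ (N⁻∖S-arc (c₁∈ at-u₁))))))
           ∷ inj₂ (inj₂ (inj₂ (inj₂ (inj₁ (N⁻∖S-arc (c₂∈ at-u₁))))))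
           ∷ []

      in-neighbour : ∀ {u x} → N⁻∖S u ≐ ｛ c₁ ｝ ∪ ｛ c₂ ｝ → Arc A x u → x ∈ H-vertices
      in-neighbour {x = x} P≐pair x→u with ∈S⊎outside x
      ... | inj₁ (inj₁ x≡u₁)        = there (here x≡u₁)
      ... | inj₁ (inj₂ (inj₁ x≡u₂)) = there (there (here x≡u₂))
      ... | inj₁ (inj₂ (inj₂ x≡u₃)) = there (there (there (here x≡u₃)))
      ... | inj₂ out with proj₁ P≐pair (Equivalence.from T-∧ (x→u , out))
      ...   | inj₁ c₁≡x = there (there (there (there (here (sym c₁≡x)))))
      ...   | inj₂ c₂≡x = there (there (there (there (there (here (sym c₂≡x))))))

      onto : ∀ {x} → InW A v u₁ u₂ u₃ x → x ∈ H-vertices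
      onto (inj₁ x≡v)                                     = here x≡v
      onto (inj₂ (inj₁ x≡u₁))                             = there (here x≡u₁)
      onto (inj₂ (inj₂ (inj₁ x≡u₂)))                      = there (there (here x≡u₂))
      onto (inj₂ (inj₂ (inj₂ (inj₁ x≡u₃))))               = there (there (there (here x≡u₃)))
      onto (inj₂ (inj₂ (inj₂ (inj₂ (inj₁ x→u₁)))))        = in-neighbour at-u₁ x→u₁
      onto (inj₂ (inj₂ (inj₂ (inj₂ (inj₂ (inj₁ x→u₂)))))) = in-neighbour at-u₂ x→u₂
      onto (inj₂ (inj₂ (inj₂ (inj₂ (inj₂ (inj₂ x→u₃)))))) = in-neighbour at-u₃ x→u₃

  H1-spanning : indegOut A u₁ u₂ u₃ u₁ ≡ 2 × indegOut A u₁ u₂ u₃ u₂ ≡ 2 × indegOut A u₁ u₂ u₃ u₃ ≡ 2 →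
                SpanningInInduced H1 A v u₁ u₂ u₃
  H1-spanning (two₁ , two₂ , two₃) =
    let _ , _ , pair = common-pair (trans (sym (indegOut≡count u₁)) two₁)
                                   (trans (sym (indegOut≡count u₂)) two₂)
                                   (trans (sym (indegOut≡count u₃)) two₃)
    in spanning pair H1 (H1-arcs pair)

  d⁻S : Fin n → ℕ
  d⁻S u = boolToℕ (A u₁ u) + boolToℕ (A u₂ u) + boolToℕ (A u₃ u)

  indeg-split : ∀ u → indeg A u ≡ d⁻S u + count (N⁻∖Sᵇ u)
  indeg-split u = begin
    indeg A u                                       ≡⟨ sum-allFin (λ z → A z u) ⟩
    count (λ z → A z u)                             ≡⟨ count-─₃ (λ z → A z u) u₁≢u₂ u₁≢u₃ u₂≢u₃ ⟩
    d⁻S u + count ((λ z → A z u) ─ u₁ ─ u₂ ─ u₃)    ≡⟨ cong (d⁻S u +_) (count-cong outside-S) ⟩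
    d⁻S u + count (N⁻∖Sᵇ u)                         ∎
    where
    open ≡-Reasoning
    outside-S : ∀ z → ((λ z → A z u) ─ u₁ ─ u₂ ─ u₃) z ≡ N⁻∖Sᵇ u z
    outside-S z = ∧-not-∨₃ (A z u) ⌊ z ≟ u₁ ⌋ ⌊ z ≟ u₂ ⌋ ⌊ z ≟ u₃ ⌋

  d⁻S+count≡3 : ∀ {u} → indeg A u ≡ 3 → d⁻S u + count (N⁻∖Sᵇ u) ≡ 3
  d⁻S+count≡3 {u} deg = trans (sym (indeg-split u)) deg

  indeg≡3⇒count≡2 : ∀ {u} → indeg A u ≡ 3 → d⁻S u ≡ 1 → count (N⁻∖Sᵇ u) ≡ 2
  indeg≡3⇒count≡2 {u} deg e≡1 =
    suc-injective (trans (cong (_+ count (N⁻∖Sᵇ u)) (sym e≡1)) (d⁻S+count≡3 deg))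

  d⁻S-total : d⁻S u₁ + d⁻S u₂ + d⁻S u₃ ≤ 3
  d⁻S-total = begin
    d⁻S u₁ + d⁻S u₂ + d⁻S u₃
      ≡⟨ regroup (a u₁ u₁) (a u₂ u₁) (a u₃ u₁) (a u₁ u₂) (a u₂ u₂) (a u₃ u₂) (a u₁ u₃) (a u₂ u₃) (a u₃ u₃) ⟩
    (a u₁ u₁ + a u₂ u₂ + a u₃ u₃) + pairs
      ≡⟨ cong (_+ pairs) loops ⟩
    pairs
      ≤⟨ +-mono-≤ (+-mono-≤ (antiparallel u₁ u₂) (antiparallel u₁ u₃)) (antiparallel u₂ u₃) ⟩
    3 ∎
    where
    open ≤-Reasoning
    a : Fin n → Fin n → ℕ
    a x y = boolToℕ (A x y)
    pairs : ℕ
    pairs = (a u₁ u₂ + a u₂ u₁) + (a u₁ u₃ + a u₃ u₁) + (a u₂ u₃ + a u₃ u₂)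
    antiparallel : ∀ x y → a x y + a y x ≤ 1
    antiparallel x y = bits≤1 (A x y) (A y x) (asym x y)
    loops : a u₁ u₁ + a u₂ u₂ + a u₃ u₃ ≡ 0
    loops = cong₂ _+_ (cong₂ _+_ (¬T⇒bit≡0 (irrefl u₁)) (¬T⇒bit≡0 (irrefl u₂))) (¬T⇒bit≡0 (irrefl u₃))
    regroup : ∀ x₁₁ x₂₁ x₃₁ x₁₂ x₂₂ x₃₂ x₁₃ x₂₃ x₃₃ →
      (x₁₁ + x₂₁ + x₃₁) + (x₁₂ + x₂₂ + x₃₂) + (x₁₃ + x₂₃ + x₃₃) ≡
      (x₁₁ + x₂₂ + x₃₃) + ((x₁₂ + x₂₁) + (x₁₃ + x₃₁) + (x₂₃ + x₃₂))
    regroup = solve-∀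

  triangle⇒d⁻S≡1 : DirectedTriangle A u₁ u₂ u₃ → d⁻S u₁ ≡ 1 × d⁻S u₂ ≡ 1 × d⁻S u₃ ≡ 1
  triangle⇒d⁻S≡1 (u₁→u₂ , u₂→u₃ , u₃→u₁) =
    cong₂ _+_ (cong₂ _+_ (¬T⇒bit≡0 (irrefl u₁)) (¬T⇒bit≡0 (asym _ _ u₁→u₂))) (T⇒bit≡1 u₃→u₁) ,
    cong₂ _+_ (cong₂ _+_ (T⇒bit≡1 u₁→u₂) (¬T⇒bit≡0 (irrefl u₂))) (¬T⇒bit≡0 (asym _ _ u₂→u₃)) ,
    cong₂ _+_ (cong₂ _+_ (¬T⇒bit≡0 (asym _ _ u₃→u₁)) (T⇒bit≡1 u₂→u₃)) (¬T⇒bit≡0 (irrefl u₃))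

  module _ (deg₁ : indeg A u₁ ≡ 3) (deg₂ : indeg A u₂ ≡ 3) (deg₃ : indeg A u₃ ≡ 3) where

    indeg≡3⇒triangle : DirectedTriangle A u₁ u₂ u₃ ⊎ DirectedTriangle A u₁ u₃ u₂
    indeg≡3⇒triangle =
      in-neighbours⇒triangle oriented (bits≢0 no-source₁) (bits≢0 no-source₂) (bits≢0 no-source₃)
      where
      e₁ e₂ e₃ : ℕ
      e₁ = d⁻S u₁
      e₂ = d⁻S u₂
      e₃ = d⁻S u₃
      e₁≤2 : e₁ ≤ 2
      e₁≤2 = bits≤2 (A u₁ u₁) (A u₂ u₁) (A u₃ u₁) (inj₁ (irrefl u₁))
      e₂≤2 : e₂ ≤ 2
      e₂≤2 = bits≤2 (A u₁ u₂) (A u₂ u₂) (A u₃ u₂) (inj₂ (inj₁ (irrefl u₂)))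
      e₃≤2 : e₃ ≤ 2
      e₃≤2 = bits≤2 (A u₁ u₃) (A u₂ u₃) (A u₃ u₃) (inj₂ (inj₂ (irrefl u₃)))
      e₁+e₂≤3 : e₁ + e₂ ≤ 3
      e₁+e₂≤3 = ≤-trans (m≤m+n (e₁ + e₂) e₃) d⁻S-total
      e₁+e₃≤3 : e₁ + e₃ ≤ 3
      e₁+e₃≤3 = ≤-trans (+-monoˡ-≤ e₃ (m≤m+n e₁ e₂)) d⁻S-total
      e₂+e₃≤3 : e₂ + e₃ ≤ 3
      e₂+e₃≤3 = ≤-trans (m≤n+m (e₂ + e₃) e₁) (≤-trans (≤-reflexive (sym (+-assoc e₁ e₂ e₃))) d⁻S-total)
      no-source₁ : e₁ ≢ 0
      no-source₁ e₁≡0 = no-SDR (SDR-swap₁₂ (SDR-swap₂₃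
        (source⇒SDR (d⁻S+count≡3 deg₂) (d⁻S+count≡3 deg₃) (d⁻S+count≡3 deg₁) e₁≡0 e₂≤2 e₃≤2 e₂+e₃≤3)))
      no-source₂ : e₂ ≢ 0
      no-source₂ e₂≡0 = no-SDR (SDR-swap₂₃
        (source⇒SDR (d⁻S+count≡3 deg₁) (d⁻S+count≡3 deg₃) (d⁻S+count≡3 deg₂) e₂≡0 e₁≤2 e₃≤2 e₁+e₃≤3))
      no-source₃ : e₃ ≢ 0
      no-source₃ e₃≡0 = no-SDR
        (source⇒SDR (d⁻S+count≡3 deg₁) (d⁻S+count≡3 deg₂) (d⁻S+count≡3 deg₃) e₃≡0 e₁≤2 e₂≤2 e₁+e₂≤3)

    triangle⇒H2-spanning : DirectedTriangle A u₁ u₂ u₃ → SpanningInInduced H2 A v u₁ u₂ u₃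
    triangle⇒H2-spanning cycle@(u₁→u₂ , u₂→u₃ , u₃→u₁) =
      let e₁≡1 , e₂≡1 , e₃≡1 = triangle⇒d⁻S≡1 cycle
          _ , _ , pair = common-pair (indeg≡3⇒count≡2 deg₁ e₁≡1) (indeg≡3⇒count≡2 deg₂ e₂≡1)
                                     (indeg≡3⇒count≡2 deg₃ e₃≡1)
      in spanning pair H2 (u₁→u₂ ∷ u₂→u₃ ∷ u₃→u₁ ∷ H1-arcs pair)

lemma2p4 : ∀ {n} (A : Digraph n) → Oriented A → S31-free A
         → (v u₁ u₂ u₃ : Fin n) → indeg A v ≥ 3
         → u₁ ≢ u₂ → u₁ ≢ u₃ → u₂ ≢ u₃
         → Arc A u₁ v → Arc A u₂ v → Arc A u₃ v
         → ((indegOut A u₁ u₂ u₃ u₁ ≡ 2 × indegOut A u₁ u₂ u₃ u₂ ≡ 2 × indegOut A u₁ u₂ u₃ u₃ ≡ 2)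
             → SpanningInInduced H1 A v u₁ u₂ u₃)
         × ((indeg A u₁ ≡ 3 × indeg A u₂ ≡ 3 × indeg A u₃ ≡ 3)
             → SpanningInInduced H2 A v u₁ u₂ u₃)
lemma2p4 A oriented free v u₁ u₂ u₃ _ u₁≢u₂ u₁≢u₃ u₂≢u₃ u₁→v u₂→v u₃→v =
  S.H1-spanning , H2-spanning
  where
  -- indeg A v ≥ 3 already follows from the arcs uᵢ → v.
  module S  = InStar A oriented free v u₁ u₂ u₃ u₁≢u₂ u₁≢u₃ u₂≢u₃ u₁→v u₂→v u₃→v
  -- A triangle u₁ → u₃ → u₂ → u₁ is the forward triangle for the order u₁, u₃, u₂.
  module S′ = InStar A oriented free v u₁ u₃ u₂ u₁≢u₃ u₁≢u₂ (≢-sym u₂≢u₃) u₁→v u₃→v u₂→v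

  H2-spanning : indeg A u₁ ≡ 3 × indeg A u₂ ≡ 3 × indeg A u₃ ≡ 3 → SpanningInInduced H2 A v u₁ u₂ u₃
  H2-spanning (deg₁ , deg₂ , deg₃) with S.indeg≡3⇒triangle deg₁ deg₂ deg₃
  ... | inj₁ u₁u₂u₃ = S.triangle⇒H2-spanning deg₁ deg₂ deg₃ u₁u₂u₃
  ... | inj₂ u₁u₃u₂ = SpanningInInduced-swap₂₃ (S′.triangle⇒H2-spanning deg₁ deg₃ deg₂ u₁u₃u₂)
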